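{- Let $U,V$ be $\lambda X$-terms which do not begin with $\lambda$. If $U$ satisfies property $(P)$ and $U\succ V$, then $V$ satisfies property $(P)$.
   Context: Application of $t$ to $u$ is written $(t)u$, and $(t)u_1\dots u_n$ means $(\dots((t)u_1)\dots)u_n$; $\overline{c}$ denotes a finite (possibly empty) sequence of terms. $\lambda X$-terms: let $\{X_i\}_{i\ge 0}$ be distinct constants. Every variable and every $X_i$ is a $\lambda X$-term; if $x$ is a variable and $u$ a $\lambda X$-term then $\lambda x u$ is one; if $u,v$ are $\lambda X$-terms then $(u)v$ is one; if $n\in\mathbb{N}$ and $a,b,\overline{c}$ are $\lambda X$-terms, then $X_{n,a,b,\overline{c}}$ is a $\lambda X$-term, regarded as a new constant (an atom not occurring in $a,b,\overline{c}$). Terms are taken modulo $\alpha$-equivalence, substitution is capture-avoiding. A head reduction step rewrites $\lambda x_1\dots\lambda x_m((\lambda x\,u)v)\overline{w}$ into $\lambda x_1\dots\lambda x_m(u[v/x])\overline{w}$ (constants are inert atoms); $U\succ V$ means $V$ is obtained from $U$ by finitely many head reduction steps. Property $(P)$: a $\lambda X$-term $U$ satisfies $(P)$ iff for each constant $X_{l,a,b,\overline{c}}$ occurring in $U$: $a,b$ and each term of $\overline{c}$ satisfy $(P)$; every occurrence of $X_{l,a,b,\overline{c}}$ in $U$ is applied to $a$ and $b$ (i.e. occurs as the head of a subterm $(X_{l,a,b,\overline{c}})ab\dots$); and $a,b$ contain no free variables that are bound in $U$. -}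

module Defs where

open import Data.Nat using (ℕ; zero; suc; _+_; _∸_; _<ᵇ_; _≡ᵇ_)
open import Data.Bool using (Bool; true; false; if_then_else_)
open import Data.List using (List; []; _∷_)
open import Data.List.Relation.Unary.All using (All)
open import Data.Empty using (⊥)
open import Data.Unit using (⊤)
open import Relation.Binary.Construct.Closure.ReflexiveTransitive using (Star)

-- λX-terms, de Bruijn indices (terms are thus taken modulo α-equivalence).
--   var i        : variable (de Bruijn index i)
--   cst i        : the constant X_i
--   lam u        : λ u
--   app t u      : (t)u
--   Xc n a b cs  : the constant X_{n,a,b,cs}; an inert atom (substitution and
--                  shifting never enter it).
data Term : Set where
  var : ℕ → Term
  cst : ℕ → Term
  lam : Term → Term
  app : Term → Term → Term
  Xc  : ℕ → Term → Term → List Term → Term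

shift : ℕ → ℕ → Term → Term
shift c d (var i) = if i <ᵇ c then var i else var (i + d)
shift c d (cst i) = cst i
shift c d (lam u) = lam (shift (suc c) d u)
shift c d (app t u) = app (shift c d t) (shift c d u)
shift c d (Xc n a b cs) = Xc n a b cs

sub : ℕ → Term → Term → Term
sub k v (var i) =
  if i <ᵇ k then var i else (if i ≡ᵇ k then shift 0 k v else var (i ∸ 1))
sub k v (cst i) = cst i
sub k v (lam u) = lam (sub (suc k) v u)
sub k v (app t u) = app (sub k v t) (sub k v u)
sub k v (Xc n a b cs) = Xc n a b cs

-- u [ v ] : u[v/x] where x is the variable bound by the λ of λx u
_[_] : Term → Term → Term
u [ v ] = sub 0 v u

-- Head reduction.
-- Spine step (no leading λ): ((λx u) v) w̄ ↦ (u[v/x]) w̄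
data _→s_ : Term → Term → Set where
  β    : ∀ {u v} → app (lam u) v →s (u [ v ])
  appL : ∀ {t t' w} → t →s t' → app t w →s app t' w

-- Head step: λx₁…λxₘ ((λx u) v) w̄ ↦ λx₁…λxₘ (u[v/x]) w̄
data _→h_ : Term → Term → Set where
  spine : ∀ {t t'} → t →s t' → t →h t'
  lamH  : ∀ {t t'} → t →h t' → lam t →h lam t'

_≻_ : Term → Term → Set
_≻_ = Star _→h_

NotLam : Term → Set
NotLam (lam _) = ⊥
NotLam _ = ⊤

NotXHead : Term → Set
NotXHead (Xc _ _ _ _) = ⊥
NotXHead (app (Xc _ _ _ _) _) = ⊥
NotXHead _ = ⊤

-- Good d t : the subterm t, occurring under d binders of the ambient term,
-- satisfies the requirements of (P): every occurrence of a constant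
-- X_{n,a,b,cs} is the head of a subterm (X_{n,a,b,cs}) a b …, where the
-- argument occurrences are literally a and b with none of their free variables
-- captured by a binder of the ambient term (in de Bruijn form: they equal a, b
-- shifted by d), and a, b and every term of cs satisfy (P).
data Good : ℕ → Term → Set where
  gvar : ∀ {d i} → Good d (var i)
  gcst : ∀ {d i} → Good d (cst i)
  glam : ∀ {d u} → Good (suc d) u → Good d (lam u)
  gapp : ∀ {d t u} → NotXHead t → Good d t → Good d u → Good d (app t u)
  gX   : ∀ {d n a b cs} →
         Good 0 a → Good 0 b → All (Good 0) cs →
         Good d (shift 0 d a) → Good d (shift 0 d b) →
         Good d (app (app (Xc n a b cs) (shift 0 d a)) (shift 0 d b))

P : Term → Set
P U = Good 0 U

-- Head reduction substitutes only into spines, and every X-constant is inert.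
-- The arguments of an occurrence of X_{n,a,b,c̄} under d binders are a and b
-- shifted by d; shifting the ambient term, or substituting into it, acts on
-- such an argument as a further shift, because none of its free variables is
-- caught by an ambient binder.  So the occurrence keeps its required shape,
-- each head step preserves (P), and hence so does ≻.
module Submission where

open import Defs
open import Data.Nat using (suc; _+_; _∸_; _<ᵇ_; _≡ᵇ_; _≤_; _<_; _<?_; z≤n; s≤s)
open import Data.Nat.Properties
open import Data.Bool using (true; false; T)
open import Data.Empty using (⊥-elim)
open import Data.Unit using (tt)
open import Function using (_∘_)
open import Relation.Binary.PropositionalEquality
open import Relation.Binary.Construct.Closure.ReflexiveTransitive using (ε; _◅_)
open import Relation.Nullary using (¬_; yes; no)

T⇒≡true : ∀ {b} → T b → b ≡ true
T⇒≡true {true} _ = refl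

¬T⇒≡false : ∀ {b} → ¬ T b → b ≡ false
¬T⇒≡false {false} _ = refl
¬T⇒≡false {true}  ¬t = ⊥-elim (¬t tt)

<⇒<ᵇ≡true : ∀ {i c} → i < c → (i <ᵇ c) ≡ true
<⇒<ᵇ≡true = T⇒≡true ∘ <⇒<ᵇ

≥⇒<ᵇ≡false : ∀ {i c} → c ≤ i → (i <ᵇ c) ≡ false
≥⇒<ᵇ≡false {i} {c} c≤i = ¬T⇒≡false (≤⇒≯ c≤i ∘ <ᵇ⇒< i c)

≢⇒≡ᵇ≡false : ∀ {i k} → ¬ i ≡ k → (i ≡ᵇ k) ≡ false
≢⇒≡ᵇ≡false {i} {k} i≢k = ¬T⇒≡false (i≢k ∘ ≡ᵇ⇒≡ i k)

k≤c+m∧c≤i⇒k<i+1+m : ∀ {k c i} m → k ≤ c + m → c ≤ i → k < i + suc m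
k≤c+m∧c≤i⇒k<i+1+m {i = i} m k≤c+m c≤i =
  ≤-<-trans (≤-trans k≤c+m (+-monoˡ-≤ m c≤i)) (+-monoʳ-< i (n<1+n m))

shift-shift : ∀ c′ c e n a → c′ ≤ c → c ≤ c′ + e →
              shift c n (shift c′ e a) ≡ shift c′ (e + n) a
shift-shift c′ c e n (var i) c′≤c c≤c′+e with i <? c′
... | yes i<c′ rewrite <⇒<ᵇ≡true i<c′ | <⇒<ᵇ≡true (<-≤-trans i<c′ c′≤c) = refl
... | no i≮c′
  rewrite ≥⇒<ᵇ≡false (≮⇒≥ i≮c′)
        | ≥⇒<ᵇ≡false (≤-trans c≤c′+e (+-monoˡ-≤ e (≮⇒≥ i≮c′))) = cong var (+-assoc i e n)
shift-shift c′ c e n (cst i) _ _ = refl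
shift-shift c′ c e n (lam a) c′≤c c≤c′+e =
  cong lam (shift-shift (suc c′) (suc c) e n a (s≤s c′≤c) (s≤s c≤c′+e))
shift-shift c′ c e n (app a b) c′≤c c≤c′+e =
  cong₂ app (shift-shift c′ c e n a c′≤c c≤c′+e) (shift-shift c′ c e n b c′≤c c≤c′+e)
shift-shift c′ c e n (Xc _ _ _ _) _ _ = refl

sub-shift : ∀ c′ k m v a → c′ ≤ k → k ≤ c′ + m →
            sub k v (shift c′ (suc m) a) ≡ shift c′ m a
sub-shift c′ k m v (var i) c′≤k k≤c′+m with i <? c′
... | yes i<c′ rewrite <⇒<ᵇ≡true i<c′ | <⇒<ᵇ≡true (<-≤-trans i<c′ c′≤k) = refl
... | no i≮c′
  with k<i+1+m ← k≤c+m∧c≤i⇒k<i+1+m m k≤c′+m (≮⇒≥ i≮c′)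
  rewrite ≥⇒<ᵇ≡false (≮⇒≥ i≮c′)
        | ≥⇒<ᵇ≡false (<⇒≤ k<i+1+m)
        | ≢⇒≡ᵇ≡false (<⇒≢ k<i+1+m ∘ sym) = cong (λ j → var (j ∸ 1)) (+-suc i m)
sub-shift c′ k m v (cst i) _ _ = refl
sub-shift c′ k m v (lam a) c′≤k k≤c′+m =
  cong lam (sub-shift (suc c′) (suc k) m v a (s≤s c′≤k) (s≤s k≤c′+m))
sub-shift c′ k m v (app a b) c′≤k k≤c′+m =
  cong₂ app (sub-shift c′ k m v a c′≤k k≤c′+m) (sub-shift c′ k m v b c′≤k k≤c′+m)
sub-shift c′ k m v (Xc _ _ _ _) _ _ = refl

Good⇒NotXHead : ∀ {d t} → Good d t → NotXHead t
Good⇒NotXHead gvar = tt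
Good⇒NotXHead gcst = tt
Good⇒NotXHead (glam _) = tt
Good⇒NotXHead (gapp {t = var _} _ _ _) = tt
Good⇒NotXHead (gapp {t = cst _} _ _ _) = tt
Good⇒NotXHead (gapp {t = lam _} _ _ _) = tt
Good⇒NotXHead (gapp {t = app _ _} _ _ _) = tt
Good⇒NotXHead (gapp {t = Xc _ _ _ _} () _ _)
Good⇒NotXHead (gX _ _ _ _ _) = tt

gapp′ : ∀ {d t u} → Good d t → Good d u → Good d (app t u)
gapp′ gt gu = gapp (Good⇒NotXHead gt) gt gu

Good-shift : ∀ {e t} c n → c ≤ e → Good e t → Good (e + n) (shift c n t)
Good-shift {t = var i} c n _ gvar with i <ᵇ c
... | true  = gvar
... | false = gvar
Good-shift c n _ gcst = gcst
Good-shift c n c≤e (glam g) = glam (Good-shift (suc c) n (s≤s c≤e) g)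
Good-shift c n c≤e (gapp _ gt gu) = gapp′ (Good-shift c n c≤e gt) (Good-shift c n c≤e gu)
Good-shift {e} c n c≤e (gX {a = a} {b} ga gb gcs _ _)
  rewrite shift-shift 0 c e n a z≤n c≤e | shift-shift 0 c e n b z≤n c≤e =
  gX ga gb gcs (Good-shift 0 (e + n) z≤n ga) (Good-shift 0 (e + n) z≤n gb)

Good-sub : ∀ k d {u v} → Good (suc (k + d)) u → Good d v → Good (k + d) (sub k v u)
Good-sub k d {var i} {v} gvar gv with i <ᵇ k
... | true = gvar
... | false with i ≡ᵇ k
...   | true  = subst (λ e → Good e (shift 0 k v)) (+-comm d k) (Good-shift 0 k z≤n gv)
...   | false = gvar
Good-sub k d gcst gv = gcst
Good-sub k d (glam g) gv = glam (Good-sub (suc k) d g gv)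
Good-sub k d (gapp _ gt gu) gv = gapp′ (Good-sub k d gt gv) (Good-sub k d gu gv)
Good-sub k d {v = v} (gX {a = a} {b} ga gb gcs _ _) gv
  rewrite sub-shift 0 k (k + d) v a z≤n (m≤m+n k d)
        | sub-shift 0 k (k + d) v b z≤n (m≤m+n k d) =
  gX ga gb gcs (Good-shift 0 (k + d) z≤n ga) (Good-shift 0 (k + d) z≤n gb)

Good-→s : ∀ {d t t′} → Good d t → t →s t′ → Good d t′
Good-→s (gapp _ (glam gu) gv) β = Good-sub 0 _ gu gv
Good-→s (gapp _ gt gw) (appL s) = gapp′ (Good-→s gt s) gw
Good-→s (gX _ _ _ _ _) (appL (appL ()))

Good-→h : ∀ {d t t′} → Good d t → t →h t′ → Good d t′
Good-→h g (spine s) = Good-→s g s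
Good-→h (glam g) (lamH s) = glam (Good-→h g s)

Good-≻ : ∀ {d t t′} → Good d t → t ≻ t′ → Good d t′
Good-≻ g ε = g
Good-≻ g (s ◅ ss) = Good-≻ (Good-→h g s) ss

-- (P) is preserved by head steps under λ as well.
lemma1 : (U V : Term) → NotLam U → NotLam V → P U → U ≻ V → P V
lemma1 U V _ _ = Good-≻
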